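{- Let $\mathcal{T}$ be a set of binary phylogenetic $X$-trees, let $S=\langle (x_1,y_1),\dots,(x_r,y_r),(x_{r+1},-)\rangle$ be a tree-child cherry picking sequence for $\mathcal{T}$, let $0\le j\le r$, and suppose that $\{x,y\}$ is a trivial cherry of $\mathcal{T}^{(j)}$ and $y$ is not forbidden with respect to $S_{1,j}$. Then there exists a tree-child cherry picking sequence $S'=\langle (x'_1,y'_1),\dots,(x'_{r'},y'_{r'}),(x'_{r'+1},-)\rangle$ for $\mathcal{T}$ such that $|S'|\le|S|$, $S'_{1,j}=S_{1,j}$, and $(x'_{j+1},y'_{j+1})=(x,y)$.
   Context: A binary phylogenetic $X'$-tree is a rooted tree whose root has out-degree 2, whose internal non-root nodes have in-degree 1 and out-degree 2, and whose leaves are bijectively labelled by $X'$ (or a single node if $|X'|=1$). A pair $\{x,y\}$ is a cherry of a tree if leaves $x,y$ are siblings. For a set of trees $\mathcal{T}$, $\{x,y\}$ is a cherry of $\mathcal{T}$ if it is a cherry of at least one tree in $\mathcal{T}$, and a trivial cherry of $\mathcal{T}$ if moreover it is a cherry of every tree in $\mathcal{T}$ containing both $x$ and $y$. A cherry picking sequence is a sequence $S=\langle (x_1,y_1),\dots,(x_r,y_r),(x_{r+1},-),\dots,(x_s,-)\rangle$ with $x_i,y_i\in X$; $|S|=s$; $S_{i,j}$ is the subsequence of the $i$th through $j$th elements (empty if $j<i$). Applying $S$ to a tree $T$: $T^{(0)}=T$, and for $j\le r$, if $\{x_j,y_j\}$ is a cherry of $T^{(j-1)}$ then $T^{(j)}$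 is obtained by deleting leaf $x_j$ and suppressing the parent of $y_j$, otherwise $T^{(j)}=T^{(j-1)}$; $T/S=T^{(r)}$; $\mathcal{T}^{(j)}=\{T^{(j)}:T\in\mathcal{T}\}$. $S$ is a cherry picking sequence for a set $\mathcal{T}$ of $X$-trees if $s>r$, $\{x_1,\dots,x_s\}=X$, and each $T/S$ ($T\in\mathcal{T}$) is a single leaf in $\{x_{r+1},\dots,x_s\}$. $S$ is tree-child if $s\le r+1$ and $y_j\ne x_i$ for all $1\le i<j\le s$. A leaf $y$ is forbidden with respect to $\langle (x_1,y_1),\dots,(x_j,y_j)\rangle$ if $y\in\{x_1,\dots,x_j\}$. -}

module Defs where

open import Data.Nat using (ℕ; _≟_; _≤_; _<_; _+_)
open import Data.Bool using (Bool; true; false; _∧_; _∨_; if_then_else_)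
open import Data.List using (List; []; _∷_; _++_; map; take; drop; length)
open import Data.List.Membership.Propositional using (_∈_; _∉_)
open import Data.List.Relation.Unary.All using (All)
open import Data.List.Relation.Unary.Any using (Any)
open import Data.List.Relation.Unary.Unique.Propositional using (Unique)
open import Data.Product using (Σ; _×_; _,_; proj₁; proj₂; ∃)
open import Function.Bundles using (_⇔_)
open import Data.Unit using (⊤)
open import Relation.Nullary.Decidable using (⌊_⌋)
open import Relation.Binary.PropositionalEquality using (_≡_)

-- Leaf labels are natural numbers; X is a finite set of labels given as a list.
Label : Set
Label = ℕ

data Tree : Set where
  leaf : Label → Tree
  node : Tree → Tree → Tree

leaves : Tree → List Label
leaves (leaf x)   = x ∷ []
leaves (node l r) = leaves l ++ leaves r

IsXTree : List Label → Tree → Set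
IsXTree X T = Unique (leaves T) × (∀ z → (z ∈ leaves T) ⇔ (z ∈ X))

data IsCherry (x y : Label) : Tree → Set where
  here-xy : IsCherry x y (node (leaf x) (leaf y))
  here-yx : IsCherry x y (node (leaf y) (leaf x))
  left    : ∀ {l r} → IsCherry x y l → IsCherry x y (node l r)
  right   : ∀ {l r} → IsCherry x y r → IsCherry x y (node l r)

isCherryNode : Label → Label → Tree → Bool
isCherryNode x y (node (leaf a) (leaf b)) =
  (⌊ a ≟ x ⌋ ∧ ⌊ b ≟ y ⌋) ∨ (⌊ a ≟ y ⌋ ∧ ⌊ b ≟ x ⌋)
isCherryNode x y _ = false

-- Picking (x,y): if {x,y} is a cherry, delete leaf x and suppress the parent
-- of y (i.e. replace the cherry node by leaf y); otherwise unchanged.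
pick : Label → Label → Tree → Tree
pick x y (leaf z) = leaf z
pick x y (node l r) =
  if isCherryNode x y (node l r) then leaf y else node (pick x y l) (pick x y r)

applyPairs : List (Label × Label) → Tree → Tree
applyPairs []             T = T
applyPairs ((x , y) ∷ ps) T = applyPairs ps (pick x y T)

-- A cherry picking sequence: pairs (x_1,y_1),…,(x_r,y_r) followed by
-- elements (x_{r+1},-),…,(x_s,-).
record CPSeq : Set where
  constructor cps
  field
    pairs : List (Label × Label)
    final : List Label
open CPSeq public

seqLength : CPSeq → ℕ
seqLength S = length (pairs S) + length (final S)

firsts : CPSeq → List Label
firsts S = map proj₁ (pairs S) ++ final S

-- S_{1,j} restricted to the pair part (used only for j ≤ r)
prefix : ℕ → CPSeq → List (Label × Label)
prefix j S = take j (pairs S)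

treesAfter : ℕ → CPSeq → List Tree → List Tree
treesAfter j S 𝒯 = map (applyPairs (prefix j S)) 𝒯

IsCPS : List Label → List Tree → CPSeq → Set
IsCPS X 𝒯 S =
  (length (pairs S) < seqLength S)
  × (∀ z → (z ∈ firsts S) ⇔ (z ∈ X))
  × All (λ T → ∃ λ z → (applyPairs (pairs S) T ≡ leaf z) × (z ∈ final S)) 𝒯

NoEarlierFirst : List Label → List (Label × Label) → Set
NoEarlierFirst seen []             = ⊤
NoEarlierFirst seen ((x , y) ∷ ps) = (y ∉ seen) × NoEarlierFirst (x ∷ seen) ps

-- S is tree-child: s ≤ r+1 and y_j ≠ x_i for all 1 ≤ i < j ≤ s
-- (for j > r there is no y_j).
IsTreeChild : CPSeq → Set
IsTreeChild S = (seqLength S ≤ length (pairs S) + 1) × NoEarlierFirst [] (pairs S)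

IsTreeChildCPS : List Label → List Tree → CPSeq → Set
IsTreeChildCPS X 𝒯 S = IsCPS X 𝒯 S × IsTreeChild S

IsCherryOfSet : Label → Label → List Tree → Set
IsCherryOfSet x y 𝒯 = Any (IsCherry x y) 𝒯

IsTrivialCherry : Label → Label → List Tree → Set
IsTrivialCherry x y 𝒯 =
  IsCherryOfSet x y 𝒯
  × All (λ T → x ∈ leaves T → y ∈ leaves T → IsCherry x y T) 𝒯

Forbidden : Label → List (Label × Label) → Set
Forbidden y ps = y ∈ map proj₁ ps

module Submission where

-- Let A be a tree of 𝒯^{(j)} and R the pairs of S after position j. Suppose first that (y,x) ∉ R.
-- Run R on A and on A with (x,y) already picked: at every stage the second tree is the first one
-- with at most one subtree collapsed onto a single leaf, because every other leaf of that subtree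
-- has already been picked as a first coordinate or is x, and tree-childness forbids later pairs
-- from using such a leaf as second coordinate.  So both runs end in the same leaf; the pairs of R
-- mentioning x are then vacuous and can be dropped, and there is at least one since the cherry
-- {x,y} of A must be reduced, so the new sequence is no longer.  If (y,x) ∈ R, then x was not
-- picked before, so {x,y} is a cherry of every tree of 𝒯^{(j)}; the argument applies to (y,x),
-- and picking (x,y) instead just swaps the labels x and y in everything that follows.

open import Defs
open import Data.Bool using (true; false)
open import Data.Bool.Properties using (∨-zeroʳ)
open import Data.Empty using (⊥; ⊥-elim)
open import Data.List using (List; []; _∷_; _++_; map; length; take; drop)
open import Data.List.Properties using (map-++; length-map; take++drop≡id)
open import Data.List.Membership.Propositional using (_∈_; _∉_; find)
open import Data.List.Membership.Propositional.Properties using (∈-++⁺ˡ; ∈-++⁺ʳ; ∈-++⁻; ∈-map⁺; ∈-map⁻)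
open import Data.List.Relation.Binary.Disjoint.Propositional using (Disjoint)
open import Data.List.Relation.Binary.Permutation.Propositional using (swap; ↭-refl)
open import Data.List.Relation.Binary.Subset.Propositional using (_⊆_)
open import Data.List.Relation.Binary.Subset.Propositional.Properties using (∷⁺ʳ; xs⊆x∷xs; ⊆-reflexive-↭)
open import Data.List.Relation.Unary.All as All using (All; []; _∷_)
import Data.List.Relation.Unary.All.Properties as Allₚ
open import Data.List.Relation.Unary.AllPairs using ([]; _∷_)
open import Data.List.Relation.Unary.Any as Any using (Any; here; there)
import Data.List.Relation.Unary.Any.Properties as Anyₚ
open import Data.List.Relation.Unary.Unique.Propositional using (Unique)
open import Data.Nat using (ℕ; zero; suc; _≟_; _≤_; _<_; z≤n; s≤s)
open import Data.Nat.Properties using (m≤n⇒m≤1+n; ≤-refl; m<m+n; +-monoˡ-≤)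
open import Data.Product as Product using (_×_; _,_; proj₁; proj₂; ∃)
open import Data.Product.Properties using (≡-dec)
open import Data.List.Membership.DecPropositional _≟_ using (_∈?_)
open import Data.List.Membership.DecPropositional (≡-dec _≟_ _≟_) using () renaming (_∈?_ to _∈ₚ?_)
open import Data.Sum as Sum using (_⊎_; inj₁; inj₂)
open import Data.Unit using (⊤; tt)
open import Function using (_∘_; _∘₂_)
open import Function.Bundles using (mk⇔; Equivalence)
open import Function.Definitions using (Injective)
open import Relation.Nullary using (¬_; yes; no)
open import Relation.Nullary.Decidable using (⌊_⌋)
open import Relation.Binary.PropositionalEquality
  using (_≡_; _≢_; refl; sym; trans; cong; cong₂; subst; module ≡-Reasoning)

module _ {A : Set} where

  take-take++ : ∀ j (xs ys : List A) → j ≤ length xs → take j (take j xs ++ ys) ≡ take j xs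
  take-take++ zero xs ys _ = refl
  take-take++ (suc j) (x ∷ xs) ys (s≤s j≤) = cong (x ∷_) (take-take++ j xs ys j≤)

  drop-take++ : ∀ j (xs ys : List A) → j ≤ length xs → drop j (take j xs ++ ys) ≡ ys
  drop-take++ zero xs ys _ = refl
  drop-take++ (suc j) (x ∷ xs) ys (s≤s j≤) = drop-take++ j xs ys j≤

  length-++-monoʳ : ∀ (xs : List A) {ys zs} → length ys ≤ length zs → length (xs ++ ys) ≤ length (xs ++ zs)
  length-++-monoʳ [] le = le
  length-++-monoʳ (_ ∷ xs) le = s≤s (length-++-monoʳ xs le)

data CherryRoot (a b : Label) : Tree → Tree → Set where
  ab : CherryRoot a b (leaf a) (leaf b)
  ba : CherryRoot a b (leaf b) (leaf a)

isCherryNode-sound : ∀ {a b} l r → isCherryNode a b (node l r) ≡ true → CherryRoot a b l r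
isCherryNode-sound {a} {b} (leaf p) (leaf q) e with p ≟ a | q ≟ b | p ≟ b | q ≟ a
... | yes refl | yes refl | _ | _ = ab
... | yes _ | no _ | yes refl | yes refl = ba
... | no _ | _ | yes refl | yes refl = ba
isCherryNode-sound (leaf _) (node _ _) ()
isCherryNode-sound (node _ _) _ ()

isCherryNode-ab : ∀ a b → isCherryNode a b (node (leaf a) (leaf b)) ≡ true
isCherryNode-ab a b with a ≟ a | b ≟ b
... | yes _ | yes _ = refl
... | no a≢a | _ = ⊥-elim (a≢a refl)
... | _ | no b≢b = ⊥-elim (b≢b refl)

isCherryNode-ba : ∀ a b → isCherryNode a b (node (leaf b) (leaf a)) ≡ true
isCherryNode-ba a b with b ≟ a | a ≟ b | b ≟ b | a ≟ a
... | _ | _ | yes _ | yes _ = ∨-zeroʳ _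
... | _ | _ | no b≢b | _ = ⊥-elim (b≢b refl)
... | _ | _ | _ | no a≢a = ⊥-elim (a≢a refl)

IsCherry⇒∈ : ∀ {a b T} → IsCherry a b T → a ∈ leaves T × b ∈ leaves T
IsCherry⇒∈ here-xy = here refl , there (here refl)
IsCherry⇒∈ here-yx = there (here refl) , here refl
IsCherry⇒∈ (left c) = let a∈ , b∈ = IsCherry⇒∈ c in ∈-++⁺ˡ a∈ , ∈-++⁺ˡ b∈
IsCherry⇒∈ (right {l} c) = let a∈ , b∈ = IsCherry⇒∈ c in ∈-++⁺ʳ (leaves l) a∈ , ∈-++⁺ʳ (leaves l) b∈

IsCherry-sym : ∀ {a b T} → IsCherry a b T → IsCherry b a T
IsCherry-sym here-xy = here-yx
IsCherry-sym here-yx = here-xy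
IsCherry-sym (left c) = left (IsCherry-sym c)
IsCherry-sym (right c) = right (IsCherry-sym c)

IsNode : Tree → Set
IsNode (leaf _) = ⊥
IsNode (node _ _) = ⊤

IsCherry⇒IsNode : ∀ {a b T} → IsCherry a b T → IsNode T
IsCherry⇒IsNode here-xy = tt
IsCherry⇒IsNode here-yx = tt
IsCherry⇒IsNode (left _) = tt
IsCherry⇒IsNode (right _) = tt

pick-nodeˡ : ∀ {a b l} r → IsNode l → pick a b (node l r) ≡ node (pick a b l) (pick a b r)
pick-nodeˡ {l = node _ _} _ _ = refl

pick-nodeʳ : ∀ {a b} l {r} → IsNode r → pick a b (node l r) ≡ node (pick a b l) (pick a b r)
pick-nodeʳ (leaf _) {node _ _} _ = refl
pick-nodeʳ (node _ _) {node _ _} _ = refl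

leaves-pick⊆ : ∀ {a b z} T → z ∈ leaves (pick a b T) → z ∈ leaves T
leaves-pick⊆ (leaf _) z∈ = z∈
leaves-pick⊆ {a} {b} (node l r) z∈ with isCherryNode a b (node l r) in eq
... | true with isCherryNode-sound l r eq | z∈
...   | ab | z∈b = there z∈b
...   | ba | here z≡b = here z≡b
leaves-pick⊆ {a} {b} (node l r) z∈ | false with ∈-++⁻ (leaves (pick a b l)) z∈
...   | inj₁ z∈l = ∈-++⁺ˡ (leaves-pick⊆ l z∈l)
...   | inj₂ z∈r = ∈-++⁺ʳ (leaves l) (leaves-pick⊆ r z∈r)

∈-leaves-pick : ∀ {a b z} T → z ∈ leaves T → z ∈ leaves (pick a b T) ⊎ (z ≡ a × IsCherry a b T)
∈-leaves-pick (leaf _) z∈ = inj₁ z∈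
∈-leaves-pick {a} {b} (node l r) z∈ with isCherryNode a b (node l r) in eq
... | true with isCherryNode-sound l r eq | z∈
...   | ab | here z≡a = inj₂ (z≡a , here-xy)
...   | ab | there z∈b = inj₁ z∈b
...   | ba | here z≡b = inj₁ (here z≡b)
...   | ba | there (here z≡a) = inj₂ (z≡a , here-yx)
∈-leaves-pick {a} {b} (node l r) z∈ | false with ∈-++⁻ (leaves l) z∈
... | inj₁ z∈l = Sum.map ∈-++⁺ˡ (Product.map₂ left) (∈-leaves-pick l z∈l)
... | inj₂ z∈r = Sum.map (∈-++⁺ʳ (leaves (pick a b l))) (Product.map₂ right) (∈-leaves-pick r z∈r)

pick-nonCherry : ∀ {a b} T → ¬ IsCherry a b T → pick a b T ≡ T
pick-nonCherry (leaf _) _ = refl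
pick-nonCherry {a} {b} (node l r) ¬c with isCherryNode a b (node l r) in eq
... | true with isCherryNode-sound l r eq
...   | ab = ⊥-elim (¬c here-xy)
...   | ba = ⊥-elim (¬c here-yx)
pick-nonCherry (node l r) ¬c | false =
  cong₂ node (pick-nonCherry l (¬c ∘ left)) (pick-nonCherry r (¬c ∘ right))

pick-∉ˡ : ∀ {a b} T → a ∉ leaves T → pick a b T ≡ T
pick-∉ˡ T a∉ = pick-nonCherry T (a∉ ∘ proj₁ ∘ IsCherry⇒∈)

pick-∉ʳ : ∀ {a b} T → b ∉ leaves T → pick a b T ≡ T
pick-∉ʳ T b∉ = pick-nonCherry T (b∉ ∘ proj₂ ∘ IsCherry⇒∈)

SamePair : Label → Label → Label → Label → Set
SamePair a b x y = (a ≡ x × b ≡ y) ⊎ (a ≡ y × b ≡ x)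

pick-IsCherry : ∀ {x y} a b T → IsCherry x y T → IsCherry x y (pick a b T) ⊎ SamePair a b x y
pick-IsCherry a b (node l r) c with isCherryNode a b (node l r) in eq
... | true with isCherryNode-sound l r eq | c
...   | ab | here-xy = inj₂ (inj₁ (refl , refl))
...   | ab | here-yx = inj₂ (inj₂ (refl , refl))
...   | ba | here-xy = inj₂ (inj₂ (refl , refl))
...   | ba | here-yx = inj₂ (inj₁ (refl , refl))
pick-IsCherry a b (node l r) here-xy | false = inj₁ here-xy
pick-IsCherry a b (node l r) here-yx | false = inj₁ here-yx
pick-IsCherry a b (node l r) (left c) | false = Sum.map₁ left (pick-IsCherry a b l c)
pick-IsCherry a b (node l r) (right c) | false = Sum.map₁ right (pick-IsCherry a b r c)

DistinctLeaves : Tree → Set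
DistinctLeaves (leaf _) = ⊤
DistinctLeaves (node l r) = DistinctLeaves l × DistinctLeaves r × Disjoint (leaves l) (leaves r)

Unique-++⁻ : ∀ (xs : List Label) {ys} → Unique (xs ++ ys) → Unique xs × Unique ys × Disjoint xs ys
Unique-++⁻ [] u = [] , u , λ ()
Unique-++⁻ (x ∷ xs) (x∉ ∷ u) =
  let uxs , uys , disj = Unique-++⁻ xs u in
  Allₚ.++⁻ˡ xs x∉ ∷ uxs , uys , λ where
    (here refl , v∈ys) → All.lookup (Allₚ.++⁻ʳ xs x∉) v∈ys refl
    (there v∈xs , v∈ys) → disj (v∈xs , v∈ys)

Unique⇒DistinctLeaves : ∀ T → Unique (leaves T) → DistinctLeaves T
Unique⇒DistinctLeaves (leaf _) _ = tt
Unique⇒DistinctLeaves (node l r) u =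
  let ul , ur , disj = Unique-++⁻ (leaves l) u in
  Unique⇒DistinctLeaves l ul , Unique⇒DistinctLeaves r ur , disj

pick-DistinctLeaves : ∀ {a b} T → DistinctLeaves T → DistinctLeaves (pick a b T)
pick-DistinctLeaves (leaf _) _ = tt
pick-DistinctLeaves {a} {b} (node l r) (dl , dr , disj) with isCherryNode a b (node l r)
... | true = tt
... | false = pick-DistinctLeaves l dl , pick-DistinctLeaves r dr ,
              λ (z∈l , z∈r) → disj (leaves-pick⊆ l z∈l , leaves-pick⊆ r z∈r)

IsCherry⇒≢ : ∀ {a b} T → DistinctLeaves T → IsCherry a b T → a ≢ b
IsCherry⇒≢ (node _ _) (_ , _ , disj) here-xy a≡b = disj (here refl , here a≡b)
IsCherry⇒≢ (node _ _) (_ , _ , disj) here-yx a≡b = disj (here refl , here (sym a≡b))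
IsCherry⇒≢ (node l _) (dl , _ , _) (left c) = IsCherry⇒≢ l dl c
IsCherry⇒≢ (node _ r) (_ , dr , _) (right c) = IsCherry⇒≢ r dr c

IsCherry-sibling : ∀ {p z q} T → DistinctLeaves T → IsCherry p z T → IsCherry z q T → p ≡ q
IsCherry-sibling (node l r) (dl , dr , disj) c c′ with c | c′
... | here-xy | here-xy = refl
... | here-xy | here-yx = refl
... | here-yx | here-xy = refl
... | here-yx | here-yx = refl
... | left c₁ | left c₂ = IsCherry-sibling l dl c₁ c₂
... | right c₁ | right c₂ = IsCherry-sibling r dr c₁ c₂
... | left c₁ | right c₂ = ⊥-elim (disj (proj₂ (IsCherry⇒∈ c₁) , proj₁ (IsCherry⇒∈ c₂)))
... | right c₁ | left c₂ = ⊥-elim (disj (proj₁ (IsCherry⇒∈ c₂) , proj₂ (IsCherry⇒∈ c₁)))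
... | here-xy | left ()
... | here-xy | right ()
... | here-yx | left ()
... | here-yx | right ()
... | left () | here-xy
... | left () | here-yx
... | right () | here-xy
... | right () | here-yx

pick-removes : ∀ {a b} T → DistinctLeaves T → IsCherry a b T → a ∉ leaves (pick a b T)
pick-removes {a} {b} (node l r) d c a∈ with isCherryNode a b (node l r) in eq
... | true with a∈
...   | here a≡b = IsCherry⇒≢ (node l r) d c a≡b
pick-removes {a} {b} (node l r) (dl , dr , disj) c a∈ | false with c
... | here-xy with () ← trans (sym eq) (isCherryNode-ab a b)
... | here-yx with () ← trans (sym eq) (isCherryNode-ba a b)
... | left c′ with ∈-++⁻ (leaves (pick a b l)) a∈
...   | inj₁ a∈l = pick-removes l dl c′ a∈l
...   | inj₂ a∈r = disj (proj₁ (IsCherry⇒∈ c′) , leaves-pick⊆ r a∈r)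
pick-removes {a} {b} (node l r) (dl , dr , disj) c a∈ | false | right c′
  with ∈-++⁻ (leaves (pick a b l)) a∈
... | inj₁ a∈l = disj (leaves-pick⊆ l a∈l , proj₁ (IsCherry⇒∈ c′))
... | inj₂ a∈r = pick-removes r dr c′ a∈r

applyPairs-++ : ∀ ps qs T → applyPairs (ps ++ qs) T ≡ applyPairs qs (applyPairs ps T)
applyPairs-++ [] qs T = refl
applyPairs-++ ((a , b) ∷ ps) qs T = applyPairs-++ ps qs (pick a b T)

applyPairs-DistinctLeaves : ∀ ps T → DistinctLeaves T → DistinctLeaves (applyPairs ps T)
applyPairs-DistinctLeaves [] T d = d
applyPairs-DistinctLeaves ((a , b) ∷ ps) T d =
  applyPairs-DistinctLeaves ps (pick a b T) (pick-DistinctLeaves T d)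

leaves-applyPairs⊆ : ∀ ps T {z} → z ∈ leaves (applyPairs ps T) → z ∈ leaves T
leaves-applyPairs⊆ [] T z∈ = z∈
leaves-applyPairs⊆ ((a , b) ∷ ps) T z∈ = leaves-pick⊆ T (leaves-applyPairs⊆ ps (pick a b T) z∈)

∈-leaves-applyPairs : ∀ ps T {z} → z ∈ leaves T → z ∈ leaves (applyPairs ps T) ⊎ z ∈ map proj₁ ps
∈-leaves-applyPairs [] T z∈ = inj₁ z∈
∈-leaves-applyPairs ((a , b) ∷ ps) T z∈ with ∈-leaves-pick {a} {b} T z∈
... | inj₂ (z≡a , _) = inj₂ (here z≡a)
... | inj₁ z∈′ = Sum.map₂ there (∈-leaves-applyPairs ps (pick a b T) z∈′)

relabel : (Label → Label) → Tree → Tree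
relabel σ (leaf z) = leaf (σ z)
relabel σ (node l r) = node (relabel σ l) (relabel σ r)

relabelPairs : (Label → Label) → List (Label × Label) → List (Label × Label)
relabelPairs σ = map (Product.map σ σ)

module _ {σ : Label → Label} (σ-inj : Injective _≡_ _≡_ σ) where

  ≟-injective : ∀ u v → ⌊ σ u ≟ σ v ⌋ ≡ ⌊ u ≟ v ⌋
  ≟-injective u v with u ≟ v | σ u ≟ σ v
  ... | yes refl | yes _ = refl
  ... | yes refl | no σu≢σu = ⊥-elim (σu≢σu refl)
  ... | no u≢v | yes σu≡σv = ⊥-elim (u≢v (σ-inj σu≡σv))
  ... | no _ | no _ = refl

  isCherryNode-relabel : ∀ a b l r →
    isCherryNode (σ a) (σ b) (node (relabel σ l) (relabel σ r)) ≡ isCherryNode a b (node l r)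
  isCherryNode-relabel a b (leaf p) (leaf q)
    rewrite ≟-injective p a | ≟-injective q b | ≟-injective p b | ≟-injective q a = refl
  isCherryNode-relabel a b (leaf _) (node _ _) = refl
  isCherryNode-relabel a b (node _ _) _ = refl

  relabel-pick : ∀ a b T → relabel σ (pick a b T) ≡ pick (σ a) (σ b) (relabel σ T)
  relabel-pick a b (leaf _) = refl
  relabel-pick a b (node l r) rewrite isCherryNode-relabel a b l r with isCherryNode a b (node l r)
  ... | true = refl
  ... | false = cong₂ node (relabel-pick a b l) (relabel-pick a b r)

  relabel-applyPairs : ∀ ps T → relabel σ (applyPairs ps T) ≡ applyPairs (relabelPairs σ ps) (relabel σ T)
  relabel-applyPairs [] T = refl
  relabel-applyPairs ((a , b) ∷ ps) T
    rewrite sym (relabel-pick a b T) = relabel-applyPairs ps (pick a b T)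

relabel-fixed : ∀ σ T → (∀ {z} → z ∈ leaves T → σ z ≡ z) → relabel σ T ≡ T
relabel-fixed σ (leaf z) fix = cong leaf (fix (here refl))
relabel-fixed σ (node l r) fix =
  cong₂ node (relabel-fixed σ l (fix ∘ ∈-++⁺ˡ)) (relabel-fixed σ r (fix ∘ ∈-++⁺ʳ (leaves l)))

transpose : Label → Label → Label → Label
transpose x y z with z ≟ x
... | yes _ = y
... | no _ with z ≟ y
...   | yes _ = x
...   | no _ = z

module _ (x y : Label) where

  transpose-x : transpose x y x ≡ y
  transpose-x with x ≟ x
  ... | yes _ = refl
  ... | no x≢x = ⊥-elim (x≢x refl)

  transpose-y : transpose x y y ≡ x
  transpose-y with y ≟ x
  ... | yes y≡x = y≡x
  ... | no _ with y ≟ y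
  ...   | yes _ = refl
  ...   | no y≢y = ⊥-elim (y≢y refl)

  transpose-other : ∀ {z} → z ≢ x → z ≢ y → transpose x y z ≡ z
  transpose-other {z} z≢x z≢y with z ≟ x
  ... | yes z≡x = ⊥-elim (z≢x z≡x)
  ... | no _ with z ≟ y
  ...   | yes z≡y = ⊥-elim (z≢y z≡y)
  ...   | no _ = refl

  transpose-involutive : ∀ z → transpose x y (transpose x y z) ≡ z
  transpose-involutive z with z ≟ x
  ... | yes refl = transpose-y
  ... | no z≢x with z ≟ y
  ...   | yes refl = transpose-x
  ...   | no z≢y = transpose-other z≢x z≢y

  transpose-injective : Injective _≡_ _≡_ (transpose x y)
  transpose-injective {u} {v} eq = begin
    u                                   ≡⟨ transpose-involutive u ⟨
    transpose x y (transpose x y u)     ≡⟨ cong (transpose x y) eq ⟩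
    transpose x y (transpose x y v)     ≡⟨ transpose-involutive v ⟩
    v                                   ∎
    where open ≡-Reasoning

  transpose-preserves : ∀ (P : Label → Set) {z} → P x → P y → P z → P (transpose x y z)
  transpose-preserves P {z} px py pz with z ≟ x
  ... | yes _ = py
  ... | no _ with z ≟ y
  ...   | yes _ = px
  ...   | no _ = pz

  private
    σ : Label → Label
    σ = transpose x y

  pick-transpose-absent : ∀ M → x ∉ leaves M → y ∉ leaves M → pick x y M ≡ relabel σ (pick y x M)
  pick-transpose-absent M x∉ y∉ = begin
    pick x y M              ≡⟨ pick-∉ˡ M x∉ ⟩
    M                       ≡⟨ relabel-fixed σ M fixed ⟨
    relabel σ M             ≡⟨ cong (relabel σ) (pick-∉ˡ M y∉) ⟨
    relabel σ (pick y x M)  ∎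
    where
    open ≡-Reasoning
    fixed : ∀ {z} → z ∈ leaves M → σ z ≡ z
    fixed z∈ = transpose-other (λ where refl → x∉ z∈) (λ where refl → y∉ z∈)

  pick-transpose : ∀ T → DistinctLeaves T → IsCherry x y T →
                   pick x y T ≡ relabel (transpose x y) (pick y x T)
  pick-transpose (node .(leaf x) .(leaf y)) _ here-xy
    rewrite isCherryNode-ab x y | isCherryNode-ba y x | transpose-x = refl
  pick-transpose (node .(leaf y) .(leaf x)) _ here-yx
    rewrite isCherryNode-ba x y | isCherryNode-ab y x | transpose-x = refl
  pick-transpose (node l r) (dl , _ , disj) (left c) = begin
    pick x y (node l r)                     ≡⟨ pick-nodeˡ r (IsCherry⇒IsNode c) ⟩
    node (pick x y l) (pick x y r)
      ≡⟨ cong₂ node (pick-transpose l dl c) (pick-transpose-absent r x∉r y∉r) ⟩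
    node (relabel σ (pick y x l)) (relabel σ (pick y x r))
      ≡⟨ cong (relabel σ) (pick-nodeˡ r (IsCherry⇒IsNode c)) ⟨
    relabel σ (pick y x (node l r))         ∎
    where
    open ≡-Reasoning
    x∉r : x ∉ leaves r
    x∉r x∈r = disj (proj₁ (IsCherry⇒∈ c) , x∈r)
    y∉r : y ∉ leaves r
    y∉r y∈r = disj (proj₂ (IsCherry⇒∈ c) , y∈r)
  pick-transpose (node l r) (_ , dr , disj) (right c) = begin
    pick x y (node l r)                     ≡⟨ pick-nodeʳ l (IsCherry⇒IsNode c) ⟩
    node (pick x y l) (pick x y r)
      ≡⟨ cong₂ node (pick-transpose-absent l x∉l y∉l) (pick-transpose r dr c) ⟩
    node (relabel σ (pick y x l)) (relabel σ (pick y x r))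
      ≡⟨ cong (relabel σ) (pick-nodeʳ l (IsCherry⇒IsNode c)) ⟨
    relabel σ (pick y x (node l r))         ∎
    where
    open ≡-Reasoning
    x∉l : x ∉ leaves l
    x∉l x∈l = disj (x∈l , proj₁ (IsCherry⇒∈ c))
    y∉l : y ∉ leaves l
    y∉l y∈l = disj (y∈l , proj₂ (IsCherry⇒∈ c))

IsCherry-mirror : ∀ {x y l r} → IsCherry x y (node l r) → IsCherry x y (node r l)
IsCherry-mirror here-xy = here-yx
IsCherry-mirror here-yx = here-xy
IsCherry-mirror (left c) = right c
IsCherry-mirror (right c) = left c

module Collapse (x y : Label) where

  -- D collects the labels already picked as first coordinates; by tree-childness none of them
  -- occurs later as a second coordinate.

  record Cluster (D : List Label) (c : Label) (K : Tree) : Set where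
    field
      isNode : IsNode K
      centre∈ : c ∈ leaves K
      others : ∀ {z} → z ∈ leaves K → z ≢ c → z ∈ D ⊎ z ≡ x
      cherry : x ∈ leaves K → IsCherry x y K

  data Collapsed (D : List Label) (c : Label) : Tree → Tree → Set where
    root : ∀ {K} → Cluster D c K → Collapsed D c K (leaf c)
    inˡ  : ∀ {A B M} → Collapsed D c A B → x ∉ leaves M → Collapsed D c (node A M) (node B M)
    inʳ  : ∀ {A B M} → Collapsed D c A B → x ∉ leaves M → Collapsed D c (node M A) (node M B)

  Simulates : List Label → Tree → Tree → Set
  Simulates D A B = A ≡ B ⊎ ∃ λ c → Collapsed D c A B

  Collapsed⇒IsNode : ∀ {D c A B} → Collapsed D c A B → IsNode A
  Collapsed⇒IsNode (root K) = Cluster.isNode K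
  Collapsed⇒IsNode (inˡ _ _) = tt
  Collapsed⇒IsNode (inʳ _ _) = tt

  Collapsed-leaf : ∀ {D c A p} → Collapsed D c A (leaf p) → p ≡ c × Cluster D c A
  Collapsed-leaf (root K) = refl , K

  Simulates-nodeˡ : ∀ {D A B M} → Simulates D A B → x ∉ leaves M → Simulates D (node A M) (node B M)
  Simulates-nodeˡ (inj₁ refl) _ = inj₁ refl
  Simulates-nodeˡ (inj₂ (c , co)) x∉M = inj₂ (c , inˡ co x∉M)

  Simulates-nodeʳ : ∀ {D A B M} → Simulates D A B → x ∉ leaves M → Simulates D (node M A) (node M B)
  Simulates-nodeʳ (inj₁ refl) _ = inj₁ refl
  Simulates-nodeʳ (inj₂ (c , co)) x∉M = inj₂ (c , inʳ co x∉M)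

  Cluster-mirror : ∀ {D c l r} → Cluster D c (node l r) → Cluster D c (node r l)
  Cluster-mirror {l = l} {r} K = record
    { isNode = tt
    ; centre∈ = Anyₚ.++-comm (leaves l) (leaves r) centre∈
    ; others = others ∘ Anyₚ.++-comm (leaves r) (leaves l)
    ; cherry = IsCherry-mirror ∘ cherry ∘ Anyₚ.++-comm (leaves r) (leaves l)
    }
    where open Cluster K

  leaf-or-Cluster : ∀ {D c} T → c ∈ leaves T → (∀ {z} → z ∈ leaves T → z ≢ c → z ∈ D ⊎ z ≡ x) →
                    (x ∈ leaves T → IsCherry x y T) → T ≡ leaf c ⊎ Cluster D c T
  leaf-or-Cluster (leaf _) (here refl) _ _ = inj₁ refl
  leaf-or-Cluster (node _ _) c∈ others cherry = inj₂ (record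
    { isNode = tt ; centre∈ = c∈ ; others = others ; cherry = cherry })

  pick-Cluster : ∀ {D c a b} K → DistinctLeaves K → Cluster D c K → b ∉ D → (a , b) ≢ (y , x) →
                 pick a b K ≡ leaf c ⊎ Cluster (a ∷ D) c (pick a b K)
  pick-Cluster {D} {c} {a} {b} K dK Kc b∉D ≢yx =
    leaf-or-Cluster (pick a b K) centre∈′ (Sum.map₁ there ∘₂ others ∘ leaves-pick⊆ K) cherry′
    where
    open Cluster Kc
    -- Deleting c needs a pick (c , b) with b a leaf of K; then b = x and c is its sibling y.
    centre∈′ : c ∈ leaves (pick a b K)
    centre∈′ with ∈-leaves-pick {a} {b} K centre∈
    ... | inj₁ c∈ = c∈
    ... | inj₂ (refl , cb) with others (proj₂ (IsCherry⇒∈ cb)) (IsCherry⇒≢ K dK cb ∘ sym)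
    ...   | inj₁ b∈D = ⊥-elim (b∉D b∈D)
    ...   | inj₂ refl with IsCherry-sibling K dK cb (cherry (proj₂ (IsCherry⇒∈ cb)))
    ...     | refl = ⊥-elim (≢yx refl)
    cherry′ : x ∈ leaves (pick a b K) → IsCherry x y (pick a b K)
    cherry′ x∈ with pick-IsCherry a b K (cherry (leaves-pick⊆ K x∈))
    ... | inj₁ xy = xy
    ... | inj₂ (inj₁ (refl , refl)) = ⊥-elim (pick-removes K dK (cherry (leaves-pick⊆ K x∈)) x∈)
    ... | inj₂ (inj₂ (refl , refl)) = ⊥-elim (≢yx refl)

  Cluster-join : ∀ {D c K w a b} → Cluster D c K → x ∉ leaves (leaf w) → SamePair a b c w →
                 Cluster (a ∷ D) b (node K (leaf w))
  Cluster-join {D} {c} {K} {w} Kc x∉w pair = record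
    { isNode = tt ; centre∈ = centre∈′ pair ; others = others′ pair ; cherry = cherry′ }
    where
    open Cluster Kc
    cherry′ : x ∈ leaves K ++ w ∷ [] → IsCherry x y (node K (leaf w))
    cherry′ x∈ with ∈-++⁻ (leaves K) x∈
    ... | inj₁ x∈K = left (cherry x∈K)
    ... | inj₂ x∈w = ⊥-elim (x∉w x∈w)
    centre∈′ : ∀ {a b} → SamePair a b c w → b ∈ leaves K ++ w ∷ []
    centre∈′ (inj₁ (refl , refl)) = ∈-++⁺ʳ (leaves K) (here refl)
    centre∈′ (inj₂ (refl , refl)) = ∈-++⁺ˡ centre∈
    others′ : ∀ {a b} → SamePair a b c w → ∀ {z} → z ∈ leaves K ++ w ∷ [] → z ≢ b → z ∈ a ∷ D ⊎ z ≡ x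
    others′ pair {z} z∈ z≢b with pair | ∈-++⁻ (leaves K) z∈
    ... | inj₁ (refl , refl) | inj₂ (here refl) = ⊥-elim (z≢b refl)
    ... | inj₂ (refl , refl) | inj₂ (here refl) = inj₁ (here refl)
    ... | inj₂ (refl , refl) | inj₁ z∈K = Sum.map₁ there (others z∈K z≢b)
    ... | inj₁ (refl , refl) | inj₁ z∈K with z ≟ c
    ...   | yes z≡c = inj₁ (here z≡c)
    ...   | no z≢c = Sum.map₁ there (others z∈K z≢c)

  pick-Collapsed : ∀ {D c a b} A B → DistinctLeaves A → Collapsed D c A B → b ∉ D → (a , b) ≢ (y , x) →
                   Simulates (a ∷ D) (pick a b A) (pick a b B)
  pick-Collapsed {c = c} K .(leaf c) dK (root Kc) b∉D ≢yx with pick-Cluster K dK Kc b∉D ≢yx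
  ... | inj₁ K↦c = inj₁ K↦c
  ... | inj₂ Kc′ = inj₂ (c , root Kc′)
  pick-Collapsed {a = a} {b} (node A M) (node B M) (dA , _ , disj) (inˡ co x∉M) b∉D ≢yx
    rewrite pick-nodeˡ {a} {b} M (Collapsed⇒IsNode co) with isCherryNode a b (node B M) in eq
  ... | false = Simulates-nodeˡ (pick-Collapsed A B dA co b∉D ≢yx) (x∉M ∘ leaves-pick⊆ M)
  ... | true with isCherryNode-sound B M eq
  ...   | ab with refl , Kc ← Collapsed-leaf co rewrite pick-∉ʳ {a} {b} A (λ b∈ → disj (b∈ , here refl)) =
          inj₂ (b , root (Cluster-join Kc x∉M (inj₁ (refl , refl))))
  ...   | ba with refl , Kc ← Collapsed-leaf co rewrite pick-∉ˡ {a} {b} A (λ a∈ → disj (a∈ , here refl)) =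
          inj₂ (b , root (Cluster-join Kc x∉M (inj₂ (refl , refl))))
  pick-Collapsed {a = a} {b} (node M A) (node M B) (_ , dA , disj) (inʳ co x∉M) b∉D ≢yx
    rewrite pick-nodeʳ {a} {b} M (Collapsed⇒IsNode co) with isCherryNode a b (node M B) in eq
  ... | false = Simulates-nodeʳ (pick-Collapsed A B dA co b∉D ≢yx) (x∉M ∘ leaves-pick⊆ M)
  ... | true with isCherryNode-sound M B eq
  ...   | ab with refl , Kc ← Collapsed-leaf co rewrite pick-∉ˡ {a} {b} A (λ a∈ → disj (here refl , a∈)) =
          inj₂ (b , root (Cluster-mirror (Cluster-join Kc x∉M (inj₂ (refl , refl)))))
  ...   | ba with refl , Kc ← Collapsed-leaf co rewrite pick-∉ʳ {a} {b} A (λ b∈ → disj (here refl , b∈)) =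
          inj₂ (b , root (Cluster-mirror (Cluster-join Kc x∉M (inj₁ (refl , refl)))))

  pick-IsCherry-Collapsed : ∀ {D} A → DistinctLeaves A → IsCherry x y A → Collapsed D y A (pick x y A)
  pick-IsCherry-Collapsed (node _ _) _ here-xy rewrite isCherryNode-ab x y = root (record
    { isNode = tt ; centre∈ = there (here refl) ; cherry = λ _ → here-xy
    ; others = λ where (here z≡x) _ → inj₂ z≡x
                       (there (here z≡y)) z≢y → ⊥-elim (z≢y z≡y) })
  pick-IsCherry-Collapsed (node _ _) _ here-yx rewrite isCherryNode-ba x y = root (record
    { isNode = tt ; centre∈ = here refl ; cherry = λ _ → here-yx
    ; others = λ where (here z≡y) z≢y → ⊥-elim (z≢y z≡y)
                       (there (here z≡x)) _ → inj₂ z≡x })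
  pick-IsCherry-Collapsed (node l r) (dl , _ , disj) (left c)
    rewrite pick-nodeˡ {x} {y} r (IsCherry⇒IsNode c)
          | pick-∉ˡ {x} {y} r (λ x∈r → disj (proj₁ (IsCherry⇒∈ c) , x∈r)) =
    inˡ (pick-IsCherry-Collapsed l dl c) (λ x∈r → disj (proj₁ (IsCherry⇒∈ c) , x∈r))
  pick-IsCherry-Collapsed (node l r) (_ , dr , disj) (right c)
    rewrite pick-nodeʳ {x} {y} l (IsCherry⇒IsNode c)
          | pick-∉ˡ {x} {y} l (λ x∈l → disj (x∈l , proj₁ (IsCherry⇒∈ c))) =
    inʳ (pick-IsCherry-Collapsed r dr c) (λ x∈l → disj (x∈l , proj₁ (IsCherry⇒∈ c)))

  pick-Simulates : ∀ D A → DistinctLeaves A → (x ∈ leaves A → IsCherry x y A) → Simulates D A (pick x y A)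
  pick-Simulates D A dA cherry with x ∈? leaves A
  ... | yes x∈ = inj₂ (y , pick-IsCherry-Collapsed A dA (cherry x∈))
  ... | no x∉ = inj₁ (sym (pick-∉ˡ A x∉))

  applyPairs-Simulates : ∀ {f} R D A B → DistinctLeaves A → Simulates D A B → NoEarlierFirst D R →
                         (y , x) ∉ R → applyPairs R A ≡ leaf f → applyPairs R B ≡ leaf f
  applyPairs-Simulates [] D A B _ (inj₁ refl) _ _ A↦f = A↦f
  applyPairs-Simulates [] D A B _ (inj₂ (_ , co)) _ _ refl with () ← Collapsed⇒IsNode co
  applyPairs-Simulates ((a , b) ∷ R) D A B dA sim (b∉D , nef) yx∉ A↦f =
    applyPairs-Simulates R (a ∷ D) (pick a b A) (pick a b B) (pick-DistinctLeaves A dA) (step sim) nef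
      (yx∉ ∘ there) A↦f
    where
    step : Simulates D A B → Simulates (a ∷ D) (pick a b A) (pick a b B)
    step (inj₁ refl) = inj₁ refl
    step (inj₂ (_ , co)) = pick-Collapsed A B dA co b∉D (yx∉ ∘ here ∘ sym)

∉-leaves-pick : ∀ {x y} A → DistinctLeaves A → (x ∈ leaves A → IsCherry x y A) → x ∉ leaves (pick x y A)
∉-leaves-pick {x} A dA cherry x∈ = pick-removes A dA (cherry (leaves-pick⊆ A x∈)) x∈

Mentions : Label → Label × Label → Set
Mentions z (a , b) = a ≡ z ⊎ b ≡ z

avoid : Label → List (Label × Label) → List (Label × Label)
avoid z [] = []
avoid z ((a , b) ∷ ps) with a ≟ z | b ≟ z
... | no _ | no _ = (a , b) ∷ avoid z ps
... | yes _ | _ = avoid z ps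
... | no _ | yes _ = avoid z ps

avoid-applyPairs : ∀ z ps B → z ∉ leaves B → applyPairs (avoid z ps) B ≡ applyPairs ps B
avoid-applyPairs z [] B z∉ = refl
avoid-applyPairs z ((a , b) ∷ ps) B z∉ with a ≟ z | b ≟ z
... | no _ | no _ = avoid-applyPairs z ps (pick a b B) (z∉ ∘ leaves-pick⊆ B)
... | yes refl | _ rewrite pick-∉ˡ {a} {b} B z∉ = avoid-applyPairs z ps B z∉
... | no _ | yes refl rewrite pick-∉ʳ {a} {b} B z∉ = avoid-applyPairs z ps B z∉

length-avoid≤ : ∀ z ps → length (avoid z ps) ≤ length ps
length-avoid≤ z [] = z≤n
length-avoid≤ z ((a , b) ∷ ps) with a ≟ z | b ≟ z
... | no _ | no _ = s≤s (length-avoid≤ z ps)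
... | yes _ | _ = m≤n⇒m≤1+n (length-avoid≤ z ps)
... | no _ | yes _ = m≤n⇒m≤1+n (length-avoid≤ z ps)

length-avoid< : ∀ z ps → Any (Mentions z) ps → length (avoid z ps) < length ps
length-avoid< z ((a , b) ∷ ps) m with a ≟ z | b ≟ z | m
... | no _ | no _ | there m′ = s≤s (length-avoid< z ps m′)
... | no a≢z | no _ | here (inj₁ a≡z) = ⊥-elim (a≢z a≡z)
... | no _ | no b≢z | here (inj₂ b≡z) = ⊥-elim (b≢z b≡z)
... | yes _ | _ | _ = s≤s (length-avoid≤ z ps)
... | no _ | yes _ | _ = s≤s (length-avoid≤ z ps)

avoid-firsts⊆ : ∀ z ps → map proj₁ (avoid z ps) ⊆ map proj₁ ps
avoid-firsts⊆ z ((a , b) ∷ ps) w∈ with a ≟ z | b ≟ z | w∈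
... | no _ | no _ | here w≡a = here w≡a
... | no _ | no _ | there w∈′ = there (avoid-firsts⊆ z ps w∈′)
... | yes _ | _ | w∈′ = there (avoid-firsts⊆ z ps w∈′)
... | no _ | yes _ | w∈′ = there (avoid-firsts⊆ z ps w∈′)

NoEarlierFirst-⊆ : ∀ {s s′} ps → s′ ⊆ s → NoEarlierFirst s ps → NoEarlierFirst s′ ps
NoEarlierFirst-⊆ [] _ _ = tt
NoEarlierFirst-⊆ ((a , b) ∷ ps) s′⊆s (b∉s , nef) = b∉s ∘ s′⊆s , NoEarlierFirst-⊆ ps (∷⁺ʳ a s′⊆s) nef

avoid-NoEarlierFirst : ∀ z {s} ps → NoEarlierFirst s ps → NoEarlierFirst (z ∷ s) (avoid z ps)
avoid-NoEarlierFirst z [] _ = tt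
avoid-NoEarlierFirst z {s} ((a , b) ∷ ps) (b∉s , nef) with a ≟ z | b ≟ z
... | no _ | no b≢z =
  (λ where (here b≡z) → b≢z b≡z ; (there b∈s) → b∉s b∈s) ,
  NoEarlierFirst-⊆ (avoid z ps) (⊆-reflexive-↭ (swap a z ↭-refl))
    (avoid-NoEarlierFirst z ps nef)
... | yes _ | _ = NoEarlierFirst-⊆ (avoid z ps) (∷⁺ʳ z (xs⊆x∷xs s a)) (avoid-NoEarlierFirst z ps nef)
... | no _ | yes _ = NoEarlierFirst-⊆ (avoid z ps) (∷⁺ʳ z (xs⊆x∷xs s a)) (avoid-NoEarlierFirst z ps nef)

seenAfter : List Label → List (Label × Label) → List Label
seenAfter s [] = s
seenAfter s ((a , _) ∷ ps) = seenAfter (a ∷ s) ps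

∈-seenAfter⁻ : ∀ s ps {w} → w ∈ seenAfter s ps → w ∈ s ⊎ w ∈ map proj₁ ps
∈-seenAfter⁻ s [] w∈ = inj₁ w∈
∈-seenAfter⁻ s ((a , _) ∷ ps) w∈ with ∈-seenAfter⁻ (a ∷ s) ps w∈
... | inj₁ (here w≡a) = inj₂ (here w≡a)
... | inj₁ (there w∈s) = inj₁ w∈s
... | inj₂ w∈ps = inj₂ (there w∈ps)

∈-seenAfter⁺ : ∀ s ps {w} → w ∈ s ⊎ w ∈ map proj₁ ps → w ∈ seenAfter s ps
∈-seenAfter⁺ s [] (inj₁ w∈s) = w∈s
∈-seenAfter⁺ s ((a , _) ∷ ps) (inj₁ w∈s) = ∈-seenAfter⁺ (a ∷ s) ps (inj₁ (there w∈s))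
∈-seenAfter⁺ s ((a , _) ∷ ps) (inj₂ (here w≡a)) = ∈-seenAfter⁺ (a ∷ s) ps (inj₁ (here w≡a))
∈-seenAfter⁺ s ((a , _) ∷ ps) (inj₂ (there w∈ps)) = ∈-seenAfter⁺ (a ∷ s) ps (inj₂ w∈ps)

NoEarlierFirst-++⁻ : ∀ s ps qs → NoEarlierFirst s (ps ++ qs) →
                     NoEarlierFirst s ps × NoEarlierFirst (seenAfter s ps) qs
NoEarlierFirst-++⁻ s [] qs nef = tt , nef
NoEarlierFirst-++⁻ s ((a , _) ∷ ps) qs (b∉s , nef) =
  Product.map₁ (b∉s ,_) (NoEarlierFirst-++⁻ (a ∷ s) ps qs nef)

NoEarlierFirst-++⁺ : ∀ s ps qs → NoEarlierFirst s ps → NoEarlierFirst (seenAfter s ps) qs →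
                     NoEarlierFirst s (ps ++ qs)
NoEarlierFirst-++⁺ s [] qs _ nef = nef
NoEarlierFirst-++⁺ s ((a , _) ∷ ps) qs (b∉s , nef₁) nef₂ = b∉s , NoEarlierFirst-++⁺ (a ∷ s) ps qs nef₁ nef₂

NoEarlierFirst-∉ : ∀ s ps {a b} → NoEarlierFirst s ps → (a , b) ∈ ps → b ∉ s
NoEarlierFirst-∉ s (_ ∷ ps) (b∉s , _) (here refl) = b∉s
NoEarlierFirst-∉ s ((a′ , _) ∷ ps) (_ , nef) (there ab∈) = NoEarlierFirst-∉ (a′ ∷ s) ps nef ab∈ ∘ there

NoEarlierFirst-¬swapped : ∀ s ps {a b} → NoEarlierFirst s ps → a ≢ b → (a , b) ∈ ps → (b , a) ∉ ps
NoEarlierFirst-¬swapped s (_ ∷ ps) _ a≢b (here refl) (here ba≡ab) = a≢b (sym (cong proj₁ ba≡ab))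
NoEarlierFirst-¬swapped s ((a , _) ∷ ps) (_ , nef) _ (here refl) (there ba∈) =
  NoEarlierFirst-∉ (a ∷ s) ps nef ba∈ (here refl)
NoEarlierFirst-¬swapped s ((b , _) ∷ ps) (_ , nef) _ (there ab∈) (here refl) =
  NoEarlierFirst-∉ (b ∷ s) ps nef ab∈ (here refl)
NoEarlierFirst-¬swapped s ((p , _) ∷ ps) (_ , nef) a≢b (there ab∈) (there ba∈) =
  NoEarlierFirst-¬swapped (p ∷ s) ps nef a≢b ab∈ ba∈

NoEarlierFirst-relabel : ∀ {σ} → Injective _≡_ _≡_ σ → ∀ s qs → NoEarlierFirst s qs →
                         NoEarlierFirst (map σ s) (relabelPairs σ qs)
NoEarlierFirst-relabel σ-inj s [] _ = tt
NoEarlierFirst-relabel {σ} σ-inj s ((a , b) ∷ qs) (b∉s , nef) =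
  σb∉σs , NoEarlierFirst-relabel σ-inj (a ∷ s) qs nef
  where
  σb∉σs : σ b ∉ map σ s
  σb∉σs σb∈ with w , w∈s , σb≡σw ← ∈-map⁻ σ σb∈ = b∉s (subst (_∈ s) (sym (σ-inj σb≡σw)) w∈s)

IsCherry-reduced⇒Mentions : ∀ {x y f} R A → IsCherry x y A → applyPairs R A ≡ leaf f → Any (Mentions x) R
IsCherry-reduced⇒Mentions [] A c refl with () ← c
IsCherry-reduced⇒Mentions ((a , b) ∷ R) A c A↦f with pick-IsCherry a b A c
... | inj₁ c′ = there (IsCherry-reduced⇒Mentions R (pick a b A) c′ A↦f)
... | inj₂ (inj₁ (a≡x , _)) = here (inj₁ a≡x)
... | inj₂ (inj₂ (_ , b≡x)) = here (inj₂ b≡x)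

module _ {f : Label} (R : List (Label × Label)) (D : List Label) (nef : NoEarlierFirst D R) where

  pick-first : ∀ {x y} A → DistinctLeaves A → (x ∈ leaves A → IsCherry x y A) → (y , x) ∉ R →
               applyPairs R A ≡ leaf f → applyPairs ((x , y) ∷ avoid x R) A ≡ leaf f
  pick-first {x} {y} A dA cherry yx∉R A↦f = begin
    applyPairs (avoid x R) (pick x y A)  ≡⟨ avoid-applyPairs x R (pick x y A) (∉-leaves-pick A dA cherry) ⟩
    applyPairs R (pick x y A)            ≡⟨ Collapse.applyPairs-Simulates x y R D A (pick x y A) dA
                                              (Collapse.pick-Simulates x y D A dA cherry) nef yx∉R A↦f ⟩
    leaf f                               ∎
    where open ≡-Reasoning

  pick-first-transposed : ∀ {x y} A → DistinctLeaves A → IsCherry x y A → (x , y) ∉ R →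
    applyPairs R A ≡ leaf f →
    applyPairs ((x , y) ∷ relabelPairs (transpose x y) (avoid y R)) A ≡ leaf (transpose x y f)
  pick-first-transposed {x} {y} A dA c xy∉R A↦f = begin
    applyPairs (relabelPairs σ (avoid y R)) (pick x y A)
      ≡⟨ cong (applyPairs (relabelPairs σ (avoid y R))) (pick-transpose x y A dA c) ⟩
    applyPairs (relabelPairs σ (avoid y R)) (relabel σ (pick y x A))
      ≡⟨ relabel-applyPairs (transpose-injective x y) (avoid y R) (pick y x A) ⟨
    relabel σ (applyPairs (avoid y R) (pick y x A))
      ≡⟨ cong (relabel σ) yx-first ⟩
    leaf (σ f)
      ∎
    where
    open ≡-Reasoning
    σ : Label → Label
    σ = transpose x y
    yx-first : applyPairs ((y , x) ∷ avoid y R) A ≡ leaf f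
    yx-first = pick-first A dA (λ _ → IsCherry-sym c) xy∉R A↦f

firsts-++⊆ : ∀ {X} (ps qs : List (Label × Label)) →
             map proj₁ ps ⊆ X → map proj₁ qs ⊆ X → map proj₁ (ps ++ qs) ⊆ X
firsts-++⊆ ps qs ps⊆X qs⊆X {w} w∈ with ∈-++⁻ (map proj₁ ps) (subst (w ∈_) (map-++ proj₁ ps qs) w∈)
... | inj₁ w∈ps = ps⊆X w∈ps
... | inj₂ w∈qs = qs⊆X w∈qs

module _ {X : List Label} {𝒯 : List Tree} (𝒯-X : All (IsXTree X) 𝒯) where

  IsTreeChildCPS-single : ∀ {T₀} → T₀ ∈ 𝒯 → ∀ ps f → NoEarlierFirst [] ps → map proj₁ ps ⊆ X → f ∈ X →
    All (λ T → applyPairs ps T ≡ leaf f) 𝒯 → IsTreeChildCPS X 𝒯 (cps ps (f ∷ []))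
  IsTreeChildCPS-single {T₀} T₀∈ ps f nef ps⊆X f∈X reduces =
    ( (m<m+n (length ps) (s≤s z≤n) , (λ z → mk⇔ (to z) (from z)) , All.map (λ T↦f → f , T↦f , here refl) reduces)
    , ≤-refl , nef )
    where
    to : ∀ z → z ∈ map proj₁ ps ++ f ∷ [] → z ∈ X
    to z z∈ with ∈-++⁻ (map proj₁ ps) z∈
    ... | inj₁ z∈ps = ps⊆X z∈ps
    ... | inj₂ (here refl) = f∈X
    from : ∀ z → z ∈ X → z ∈ map proj₁ ps ++ f ∷ []
    from z z∈X with ∈-leaves-applyPairs ps T₀ (Equivalence.from (proj₂ (All.lookup 𝒯-X T₀∈) z) z∈X)
    ... | inj₂ z∈ps = ∈-++⁺ˡ z∈ps
    ... | inj₁ z∈T rewrite All.lookup reduces T₀∈ = ∈-++⁺ʳ (map proj₁ ps) z∈T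

firsts-relabelPairs : ∀ σ qs → map proj₁ (relabelPairs σ qs) ≡ map σ (map proj₁ qs)
firsts-relabelPairs σ [] = refl
firsts-relabelPairs σ ((a , _) ∷ qs) = cong (σ a ∷_) (firsts-relabelPairs σ qs)

module CherryFirst {X : List Label} {𝒯 : List Tree} (𝒯-X : All (IsXTree X) 𝒯)
  (pre R : List (Label × Label)) (f : Label) (S-tc : IsTreeChildCPS X 𝒯 (cps (pre ++ R) (f ∷ [])))
  {x y : Label} (trivial : IsTrivialCherry x y (map (applyPairs pre) 𝒯)) (y∉pre : y ∉ map proj₁ pre)
  where

  Rearranged : Set
  Rearranged = ∃ λ rest → ∃ λ f′ →
    IsTreeChildCPS X 𝒯 (cps (pre ++ (x , y) ∷ rest) (f′ ∷ [])) × length rest < length R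

  private
    s : List Label
    s = seenAfter [] pre
    A : Tree → Tree
    A = applyPairs pre

    nefPre : NoEarlierFirst [] pre
    nefPre = proj₁ (NoEarlierFirst-++⁻ [] pre R (proj₂ (proj₂ S-tc)))
    nefR : NoEarlierFirst s R
    nefR = proj₂ (NoEarlierFirst-++⁻ [] pre R (proj₂ (proj₂ S-tc)))

    firsts⊆X : map proj₁ (pre ++ R) ++ f ∷ [] ⊆ X
    firsts⊆X = Equivalence.to (proj₁ (proj₂ (proj₁ S-tc)) _)
    pre⊆X : map proj₁ pre ⊆ X
    pre⊆X = firsts⊆X ∘ ∈-++⁺ˡ ∘ subst (_ ∈_) (sym (map-++ proj₁ pre R)) ∘ ∈-++⁺ˡ
    R⊆X : map proj₁ R ⊆ X
    R⊆X = firsts⊆X ∘ ∈-++⁺ˡ ∘ subst (_ ∈_) (sym (map-++ proj₁ pre R)) ∘ ∈-++⁺ʳ (map proj₁ pre)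
    f∈X : f ∈ X
    f∈X = firsts⊆X (∈-++⁺ʳ (map proj₁ (pre ++ R)) (here refl))

    witness : ∃ λ T → T ∈ 𝒯 × IsCherry x y (A T)
    witness = find (Anyₚ.map⁻ (proj₁ trivial))
    T₀ : Tree
    T₀ = proj₁ witness
    T₀∈ : T₀ ∈ 𝒯
    T₀∈ = proj₁ (proj₂ witness)
    c₀ : IsCherry x y (A T₀)
    c₀ = proj₂ (proj₂ witness)

    leaves⊆X : ∀ {T} → T ∈ 𝒯 → leaves T ⊆ X
    leaves⊆X T∈ = Equivalence.to (proj₂ (All.lookup 𝒯-X T∈) _)
    X⊆leaves : ∀ {T} → T ∈ 𝒯 → X ⊆ leaves T
    X⊆leaves T∈ = Equivalence.from (proj₂ (All.lookup 𝒯-X T∈) _)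

    dA : ∀ {T} → T ∈ 𝒯 → DistinctLeaves (A T)
    dA {T} T∈ = applyPairs-DistinctLeaves pre T (Unique⇒DistinctLeaves T (proj₁ (All.lookup 𝒯-X T∈)))

    A↦f : ∀ {T} → T ∈ 𝒯 → applyPairs R (A T) ≡ leaf f
    A↦f {T} T∈ with All.lookup (proj₂ (proj₂ (proj₁ S-tc))) T∈
    ... | _ , S↦z , here refl = trans (sym (applyPairs-++ pre R T)) S↦z

    x∈X : x ∈ X
    x∈X = leaves⊆X T₀∈ (leaves-applyPairs⊆ pre T₀ (proj₁ (IsCherry⇒∈ c₀)))
    y∈X : y ∈ X
    y∈X = leaves⊆X T₀∈ (leaves-applyPairs⊆ pre T₀ (proj₂ (IsCherry⇒∈ c₀)))

    y∉s : y ∉ s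
    y∉s y∈s with ∈-seenAfter⁻ [] pre y∈s
    ... | inj₂ y∈pre = y∉pre y∈pre

    y∈A : ∀ {T} → T ∈ 𝒯 → y ∈ leaves (A T)
    y∈A {T} T∈ with ∈-leaves-applyPairs pre T (X⊆leaves T∈ y∈X)
    ... | inj₁ y∈ = y∈
    ... | inj₂ y∈pre = ⊥-elim (y∉pre y∈pre)

    cherryA : ∀ {T} → T ∈ 𝒯 → x ∈ leaves (A T) → IsCherry x y (A T)
    cherryA T∈ x∈ = All.lookup (Allₚ.map⁻ (proj₂ trivial)) T∈ x∈ (y∈A T∈)

    rearranged : ∀ rest f′ → (∀ {T} → T ∈ 𝒯 → applyPairs ((x , y) ∷ rest) (A T) ≡ leaf f′) →
                 NoEarlierFirst s ((x , y) ∷ rest) → map proj₁ rest ⊆ X → f′ ∈ X →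
                 length rest < length R → Rearranged
    rearranged rest f′ reduces nef rest⊆X f′∈X shorter =
      rest , f′ ,
      IsTreeChildCPS-single 𝒯-X T₀∈ (pre ++ R′) f′ (NoEarlierFirst-++⁺ [] pre R′ nefPre nef)
        (firsts-++⊆ pre R′ pre⊆X R′⊆X) f′∈X
        (All.tabulate λ {T} T∈ → trans (applyPairs-++ pre R′ T) (reduces T∈)) ,
      shorter
      where
      R′ : List (Label × Label)
      R′ = (x , y) ∷ rest
      R′⊆X : map proj₁ R′ ⊆ X
      R′⊆X (here refl) = x∈X
      R′⊆X (there w∈) = rest⊆X w∈

    fresh : (y , x) ∉ R → Rearranged
    fresh yx∉R = rearranged (avoid x R) f
      (λ T∈ → pick-first R s nefR _ (dA T∈) (cherryA T∈) yx∉R (A↦f T∈))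
      (y∉s , avoid-NoEarlierFirst x R nefR) (R⊆X ∘ avoid-firsts⊆ x R) f∈X
      (length-avoid< x R (IsCherry-reduced⇒Mentions R (A T₀) c₀ (A↦f T₀∈)))

    swapped : (y , x) ∈ R → Rearranged
    swapped yx∈R = rearranged (relabelPairs σ (avoid y R)) (σ f)
      (λ T∈ → pick-first-transposed R s nefR _ (dA T∈) (cherryA T∈ (x∈A T∈)) xy∉R (A↦f T∈))
      (y∉s , nef) rest⊆X (σ-preserves-X f∈X) shorter
      where
      σ : Label → Label
      σ = transpose x y
      σ-preserves-X : ∀ {z} → z ∈ X → σ z ∈ X
      σ-preserves-X = transpose-preserves x y (_∈ X) x∈X y∈X
      x∉s : x ∉ s
      x∉s = NoEarlierFirst-∉ s R nefR yx∈R
      x∈A : ∀ {T} → T ∈ 𝒯 → x ∈ leaves (A T)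
      x∈A {T} T∈ with ∈-leaves-applyPairs pre T (X⊆leaves T∈ x∈X)
      ... | inj₁ x∈ = x∈
      ... | inj₂ x∈pre = ⊥-elim (x∉s (∈-seenAfter⁺ [] pre (inj₂ x∈pre)))
      xy∉R : (x , y) ∉ R
      xy∉R xy∈R = NoEarlierFirst-¬swapped s R nefR (IsCherry⇒≢ (A T₀) (dA T₀∈) c₀) xy∈R yx∈R
      s⊆σs : x ∷ s ⊆ map σ (y ∷ s)
      s⊆σs (here refl) = here (sym (transpose-y x y))
      s⊆σs (there {w} w∈s) = there (subst (_∈ map σ s)
        (transpose-other x y (λ where refl → x∉s w∈s) (λ where refl → y∉s w∈s)) (∈-map⁺ σ w∈s))
      nef : NoEarlierFirst (x ∷ s) (relabelPairs σ (avoid y R))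
      nef = NoEarlierFirst-⊆ (relabelPairs σ (avoid y R)) s⊆σs
        (NoEarlierFirst-relabel (transpose-injective x y) (y ∷ s) (avoid y R) (avoid-NoEarlierFirst y R nefR))
      rest⊆X : map proj₁ (relabelPairs σ (avoid y R)) ⊆ X
      rest⊆X w∈ with v , v∈ , refl ← ∈-map⁻ σ (subst (_ ∈_) (firsts-relabelPairs σ (avoid y R)) w∈) =
        σ-preserves-X (R⊆X (avoid-firsts⊆ y R v∈))
      shorter : length (relabelPairs σ (avoid y R)) < length R
      shorter = subst (_< length R) (sym (length-map (Product.map σ σ) (avoid y R)))
        (length-avoid< y R (Any.map (λ where refl → inj₁ refl) yx∈R))

  cherry-first : Rearranged
  cherry-first with (y , x) ∈ₚ? R
  ... | yes yx∈R = swapped yx∈R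
  ... | no yx∉R = fresh yx∉R

proposition8 : (X : List Label) (𝒯 : List Tree) → All (IsXTree X) 𝒯 →
    (S : CPSeq) → IsTreeChildCPS X 𝒯 S → length (final S) ≡ 1 →
    (j : ℕ) → j ≤ length (pairs S) →
    (x y : Label) → IsTrivialCherry x y (treesAfter j S 𝒯) →
    ¬ Forbidden y (prefix j S) →
    ∃ λ (S' : CPSeq) → IsTreeChildCPS X 𝒯 S' × length (final S') ≡ 1
      × seqLength S' ≤ seqLength S
      × prefix j S' ≡ prefix j S
      × ∃ λ rest → drop j (pairs S') ≡ (x , y) ∷ rest
proposition8 X 𝒯 𝒯-X (cps ps (f ∷ [])) S-tc refl j j≤r x y trivial y∉pre
  with rest , f′ , S′-tc , shorter ← CherryFirst.cherry-first 𝒯-X (take j ps) (drop j ps) f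
         (subst (λ qs → IsTreeChildCPS X 𝒯 (cps qs (f ∷ []))) (sym (take++drop≡id j ps)) S-tc) trivial y∉pre
  = cps (take j ps ++ (x , y) ∷ rest) (f′ ∷ []) , S′-tc , refl , +-monoˡ-≤ 1 no-longer ,
    take-take++ j ps _ j≤r , rest , drop-take++ j ps _ j≤r
  where
  no-longer : length (take j ps ++ (x , y) ∷ rest) ≤ length ps
  no-longer = subst (length (take j ps ++ (x , y) ∷ rest) ≤_) (cong length (take++drop≡id j ps))
                (length-++-monoʳ (take j ps) shorter)
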